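{- For an integer $h\ge0$ let $\mathcal{D}_h$ be the set of Dyck paths of height at most $h$, and for a Dyck path $\pi$ let $n(\pi)$ be half its number of steps, $m(\pi)$ the sum of the starting heights of its $(1,1)$ steps, $u(\pi)$ the number of its vertices on the line $y=0$ other than $(0,0)$, and $v(\pi)$ the number of its vertices on the line $y=h$. Let $D_h(a,b;q,t)=\sum_{\pi\in\mathcal{D}_h} a^{u(\pi)}b^{v(\pi)}q^{m(\pi)}t^{n(\pi)}$. Then $D_0(a,b;q,t)=b$, $D_1(a,b;q,t)=1/(1-abt)$, and for $h\geq2$, $$ D_h(a,b;q,t)=\cfrac{1}{1-\cfrac{c_1}{1-\cfrac{c_2}{1-\cdots\cfrac{c_{h-1}}{1-bq^{h-1}t}}}}, $$ where the $h-1$ partial numerators are $c_1=at$ and $c_k=q^{k-1}t$ for $2\le k\le h-1$ (so for $h=2$ this reads $D_2=1/(1-at/(1-bqt))$).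
   Context: A Dyck path is a walk on $\mathbb{Z}^2$ starting at $(0,0)$, with steps in directions $(1,1)$ and $(1,-1)$, having no vertex with negative $y$-coordinate, and ending on the line $y=0$ (the zero-step path is included). It has height at most $h$ if all its vertices lie between $y=0$ and $y=h$. Generating functions are formal power series in $t$. -}

module Defs where

open import Level using (_⊔_)
open import Algebra.Bundles using (CommutativeRing)
open import Data.Nat as ℕ using (ℕ; zero; suc; _∸_)
open import Data.Integer as ℤ using (ℤ; +_; 0ℤ; 1ℤ; ∣_∣)
open import Data.List using (List; []; _∷_; map; filter; upTo; concatMap; length; drop; foldr)
open import Data.List.Relation.Unary.All using (All; all?)
open import Data.Product using (_×_)
open import Relation.Binary.PropositionalEquality using (_≡_)
open import Relation.Nullary using (Dec)
open import Relation.Nullary.Decidable using (_×-dec_)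

-- Lattice walks with steps U = (1,1) and D = (1,-1), as step words.

data Step : Set where
  U D : Step

next : ℤ → Step → ℤ
next y U = y ℤ.+ 1ℤ
next y D = y ℤ.- 1ℤ

vertices : ℤ → List Step → List ℤ
vertices y []       = y ∷ []
vertices y (s ∷ ss) = y ∷ vertices (next y s) ss

endHeight : ℤ → List Step → ℤ
endHeight y []       = y
endHeight y (s ∷ ss) = endHeight (next y s) ss

IsDyck≤ : ℕ → List Step → Set
IsDyck≤ h p = All (λ y → (0ℤ ℤ.≤ y) × (y ℤ.≤ + h)) (vertices 0ℤ p) × (endHeight 0ℤ p ≡ 0ℤ)

isDyck≤? : (h : ℕ) → (p : List Step) → Dec (IsDyck≤ h p)
isDyck≤? h p = all? (λ y → (0ℤ ℤ.≤? y) ×-dec (y ℤ.≤? + h)) (vertices 0ℤ p) ×-dec (endHeight 0ℤ p ℤ.≟ 0ℤ)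

words : ℕ → List (List Step)
words zero    = [] ∷ []
words (suc k) = concatMap (λ w → (U ∷ w) ∷ (D ∷ w) ∷ []) (words k)

upHeights : ℤ → List Step → List ℤ
upHeights y []       = []
upHeights y (U ∷ ss) = y ∷ upHeights (next y U) ss
upHeights y (D ∷ ss) = upHeights (next y D) ss

statU : List Step → ℕ
statU p = length (filter (λ y → y ℤ.≟ 0ℤ) (drop 1 (vertices 0ℤ p)))

statV : ℕ → List Step → ℕ
statV h p = length (filter (λ y → y ℤ.≟ + h) (vertices 0ℤ p))

-- m: sum of starting heights of up steps (nonnegative for Dyck paths)
statM : List Step → ℕ
statM p = foldr ℕ._+_ 0 (map ∣_∣ (upHeights 0ℤ p))

-- Formal power series in t over a commutative ring R, as coefficient
-- sequences; generating function D_h with a, b, q specialised to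
-- arbitrary ring elements (take R = ℤ[a,b,q] for the universal case).

module _ {c ℓ} (R : CommutativeRing c ℓ) where
  open CommutativeRing R

  PS : Set c
  PS = ℕ → Carrier

  _≋_ : PS → PS → Set ℓ
  f ≋ g = ∀ n → f n ≈ g n

  sumR : List Carrier → Carrier
  sumR = foldr _+_ 0#

  pow : Carrier → ℕ → Carrier
  pow x zero    = 1#
  pow x (suc k) = x * pow x k

  constPS : Carrier → PS
  constPS x zero    = x
  constPS x (suc n) = 0#

  scale : Carrier → PS → PS
  scale x f n = x * f n

  conv : PS → PS → PS
  conv f g n = sumR (map (λ i → f i * g (n ∸ i)) (upTo (suc n)))

  powPS : PS → ℕ → PS
  powPS Y zero    = constPS 1#
  powPS Y (suc k) = conv Y (powPS Y k)

  -- geo Y = 1 / (1 - t·Y) = Σ_k t^k Y^k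
  geo : PS → PS
  geo Y n = sumR (map (λ k → powPS Y k (n ∸ k)) (upTo (suc n)))

  -- cf (e₁ ∷ … ∷ e_r) d = 1/(1 - e₁ t/(1 - e₂ t/(… /(1 - e_r t/(1 - d t)))))
  cf : List Carrier → Carrier → PS
  cf []       d = geo (constPS d)
  cf (e ∷ es) d = geo (scale e (cf es d))

  weight : ℕ → Carrier → Carrier → Carrier → List Step → Carrier
  weight h a b q p = pow a (statU p) * (pow b (statV h p) * pow q (statM p))

  Dgf : ℕ → Carrier → Carrier → Carrier → PS
  Dgf h a b q n = sumR (map (weight h a b q) (filter (isDyck≤? h) (words (2 ℕ.* n))))

module Submission where

open import Defs
open import Algebra.Bundles using (CommutativeRing)
open import Data.Nat using (ℕ; suc; _≤_; _∸_)
open import Data.List using (_∷_; map; upTo)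
open import Data.Product using (_×_)

open import Data.Bool using (true; false; if_then_else_)
open import Data.Empty using (⊥-elim)
open import Data.Integer as ℤ using (ℤ; +_; 0ℤ; -[1+_]; ∣_∣; +≤+)
import Data.Integer.Properties as IP
open import Data.List using (List; []; applyUpTo; filter; length; drop; foldr; concatMap)
open import Data.List.Properties using (map-upTo)
open import Data.List.Relation.Unary.All using (All; all?; _∷_; [])
open import Data.Nat as ℕ using (zero; _<_; z≤n; s≤s)
import Data.Nat.Properties as NP
open import Data.Product using (_,_)
open import Data.Sum using (inj₁; inj₂)
open import Function using (_∘_)
open import Relation.Nullary using (Dec; yes; no; does; ¬_)
open import Relation.Nullary.Decidable using (_×-dec_; dec-false; dec-true)
open import Relation.Unary using (Decidable)
import Relation.Binary.PropositionalEquality as ≡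
open ≡ using (_≡_)

-- Counting the statistics u, v, m step by step, the weight of a walk is a
-- product of one weight per step depending only on the starting height of
-- the step.  Hence the weighted count paths y k of admissible walks of
-- length k from height y (staying in 0 ≤ y ≤ h, ending at 0) satisfies a
-- transfer equation in the first step (Walks, Heights).  An admissible walk
-- from height y splits at its last visits to y, y-1, …, 0 into excursions
-- E y, E (y-1), …, E 0 joined by down steps, and E y = 1/(1 - arch y · t · E (y+1))
-- by the first-return decomposition, arch y being the weight of an up step
-- from y paired with the down step back to y.  Rather than building this
-- bijection, we check that the resulting product formula solves the transfer
-- equation (Excursions.ClosedForm), using a small algebra of formal power
-- series (Series).  Then D_h = E 0 for h ≥ 1; evaluating the arch weights
-- (ArchWeights) turns E 0 into the continued fraction.  The case h = 0 is
-- direct: only the empty path survives.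

module RingSums {c ℓ} (R : CommutativeRing c ℓ) where
  open CommutativeRing R
  open import Algebra.Solver.Ring.NaturalCoefficients.Default commutativeSemiring

  private
    ∑ : {A : Set} → List A → (A → Carrier) → Carrier
    ∑ xs f = sumR R (map f xs)

  sum-cong : {A : Set} (xs : List A) {f g : A → Carrier} → (∀ x → f x ≈ g x) → ∑ xs f ≈ ∑ xs g
  sum-cong []       f≈g = refl
  sum-cong (x ∷ xs) f≈g = +-cong (f≈g x) (sum-cong xs f≈g)

  sum-+ : {A : Set} (xs : List A) (f g : A → Carrier) → ∑ xs (λ x → f x + g x) ≈ ∑ xs f + ∑ xs g
  sum-+ []       f g = sym (+-identityˡ 0#)
  sum-+ (x ∷ xs) f g = trans (+-congˡ (sum-+ xs f g))
    (solve 4 (λ u v s t → (u :+ v) :+ (s :+ t) := (u :+ s) :+ (v :+ t)) refl (f x) (g x) (∑ xs f) (∑ xs g))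

  sum-*ˡ : {A : Set} (xs : List A) (z : Carrier) (f : A → Carrier) → ∑ xs (λ x → z * f x) ≈ z * ∑ xs f
  sum-*ˡ []       z f = sym (zeroʳ z)
  sum-*ˡ (x ∷ xs) z f = trans (+-congˡ (sum-*ˡ xs z f)) (sym (distribˡ z (f x) (∑ xs f)))

  sum-zero : {A : Set} (xs : List A) {f : A → Carrier} → (∀ x → f x ≈ 0#) → ∑ xs f ≈ 0#
  sum-zero []       f≈0 = refl
  sum-zero (x ∷ xs) f≈0 = trans (+-cong (f≈0 x) (sum-zero xs f≈0)) (+-identityˡ 0#)

  keep : {p : _} {P : Set p} → Dec P → Carrier → Carrier
  keep (yes _) x = x
  keep (no _)  x = 0#

  sum-filter : {A : Set} {P : A → Set} (P? : Decidable P) (xs : List A) (f : A → Carrier) →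
               ∑ (filter P? xs) f ≈ ∑ xs (λ x → keep (P? x) (f x))
  sum-filter P? []       f = refl
  sum-filter P? (x ∷ xs) f with P? x
  ... | yes _ = +-congˡ (sum-filter P? xs f)
  ... | no  _ = trans (sum-filter P? xs f) (sym (+-identityˡ _))

  pow-+ : ∀ x i j → pow R x (i ℕ.+ j) ≈ pow R x i * pow R x j
  pow-+ x zero    j = sym (*-identityˡ _)
  pow-+ x (suc i) j = trans (*-congˡ (pow-+ x i j)) (sym (*-assoc _ _ _))

map-upTo-suc : ∀ {a} {A : Set a} (f : ℕ → A) (n : ℕ) → map f (upTo (suc n)) ≡ f 0 ∷ map (f ∘ suc) (upTo n)
map-upTo-suc f n = ≡.trans (map-upTo f (suc n)) (≡.cong (f 0 ∷_) (≡.sym (map-upTo (f ∘ suc) n)))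

module Series {c ℓ} (R : CommutativeRing c ℓ) where
  open CommutativeRing R
  open RingSums R
  open import Algebra.Solver.Ring.NaturalCoefficients.Default commutativeSemiring
  open import Relation.Binary.Reasoning.Setoid setoid

  infixl 7 _⋆_
  _⋆_ : PS R → PS R → PS R
  _⋆_ = conv R

  -- Antidiagonal sum Σ_{i+j=n} B i j; both f ⋆ g and geo are of this form.
  ΣΔ : (ℕ → ℕ → Carrier) → ℕ → Carrier
  ΣΔ B n = sumR R (map (λ k → B k (n ∸ k)) (upTo (suc n)))

  -- Multiplication by t.
  shift : PS R → PS R
  shift X zero    = 0#
  shift X (suc n) = X n

  ΣΔ-cong : ∀ n {A B : ℕ → ℕ → Carrier} → (∀ i j → A i j ≈ B i j) → ΣΔ A n ≈ ΣΔ B n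
  ΣΔ-cong n A≈B = sum-cong (upTo (suc n)) (λ k → A≈B k (n ∸ k))

  ΣΔ-+ : ∀ n (A B : ℕ → ℕ → Carrier) → ΣΔ (λ i j → A i j + B i j) n ≈ ΣΔ A n + ΣΔ B n
  ΣΔ-+ n A B = sum-+ (upTo (suc n)) (λ k → A k (n ∸ k)) (λ k → B k (n ∸ k))

  ΣΔ-*ˡ : ∀ n x (A : ℕ → ℕ → Carrier) → ΣΔ (λ i j → x * A i j) n ≈ x * ΣΔ A n
  ΣΔ-*ˡ n x A = sum-*ˡ (upTo (suc n)) x (λ k → A k (n ∸ k))

  ΣΔ-first : ∀ n (B : ℕ → ℕ → Carrier) → ΣΔ B n ≈ B 0 n + shift (ΣΔ (B ∘ suc)) n
  ΣΔ-first zero    B = refl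
  ΣΔ-first (suc n) B = reflexive (≡.cong (sumR R) (map-upTo-suc (λ k → B k (suc n ∸ k)) (suc n)))

  ΣΔ-last : ∀ n (B : ℕ → ℕ → Carrier) → ΣΔ B (suc n) ≈ ΣΔ (λ i j → B i (suc j)) n + B (suc n) 0
  ΣΔ-last zero B = begin
    ΣΔ B 1                       ≈⟨ ΣΔ-first 1 B ⟩
    B 0 1 + (B 1 0 + 0#)         ≈⟨ solve 2 (λ x y → x :+ (y :+ con 0) := (x :+ con 0) :+ y) refl (B 0 1) (B 1 0) ⟩
    (B 0 1 + 0#) + B 1 0         ∎
  ΣΔ-last (suc n) B = begin
    ΣΔ B (suc (suc n))                                                   ≈⟨ ΣΔ-first (suc (suc n)) B ⟩
    B 0 (suc (suc n)) + ΣΔ (B ∘ suc) (suc n)                             ≈⟨ +-congˡ (ΣΔ-last n (B ∘ suc)) ⟩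
    B 0 (suc (suc n)) + (ΣΔ (λ i j → B (suc i) (suc j)) n + B (suc (suc n)) 0) ≈⟨ sym (+-assoc _ _ _) ⟩
    (B 0 (suc (suc n)) + ΣΔ (λ i j → B (suc i) (suc j)) n) + B (suc (suc n)) 0
      ≈⟨ +-congʳ (sym (ΣΔ-first (suc n) (λ i j → B i (suc j)))) ⟩
    ΣΔ (λ i j → B i (suc j)) (suc n) + B (suc (suc n)) 0                 ∎

  ΣΔ-shift : ∀ n (Z : ℕ → PS R) → ΣΔ (shift ∘ Z) n ≈ shift (ΣΔ Z) n
  ΣΔ-shift zero    Z = +-identityˡ 0#
  ΣΔ-shift (suc n) Z = trans (ΣΔ-last n (shift ∘ Z)) (+-identityʳ _)

  ⋆-cong : ∀ n {f f′ g g′ : PS R} → _≋_ R f f′ → _≋_ R g g′ → (f ⋆ g) n ≈ (f′ ⋆ g′) n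
  ⋆-cong n f≈f′ g≈g′ = ΣΔ-cong n (λ i j → *-cong (f≈f′ i) (g≈g′ j))

  ⋆-first : ∀ n (f g : PS R) → (f ⋆ g) n ≈ f 0 * g n + shift ((f ∘ suc) ⋆ g) n
  ⋆-first n f g = ΣΔ-first n (λ i j → f i * g j)

  ⋆-distribʳ : ∀ n (f f′ g : PS R) → ((λ i → f i + f′ i) ⋆ g) n ≈ (f ⋆ g) n + (f′ ⋆ g) n
  ⋆-distribʳ n f f′ g = trans (ΣΔ-cong n (λ i j → distribʳ (g j) (f i) (f′ i)))
                              (ΣΔ-+ n (λ i j → f i * g j) (λ i j → f′ i * g j))

  ⋆-scaleˡ : ∀ n x (f g : PS R) → (scale R x f ⋆ g) n ≈ x * (f ⋆ g) n
  ⋆-scaleˡ n x f g = trans (ΣΔ-cong n (λ i j → *-assoc x (f i) (g j))) (ΣΔ-*ˡ n x (λ i j → f i * g j))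

  ⋆-identityˡ : ∀ n (g : PS R) → (constPS R 1# ⋆ g) n ≈ g n
  ⋆-identityˡ n g = begin
    (constPS R 1# ⋆ g) n                               ≈⟨ ⋆-first n (constPS R 1#) g ⟩
    1# * g n + shift ((λ _ → 0#) ⋆ g) n                ≈⟨ +-cong (*-identityˡ (g n)) (tail n) ⟩
    g n + 0#                                           ≈⟨ +-identityʳ (g n) ⟩
    g n                                                ∎
    where
    tail : ∀ n → shift ((λ _ → 0#) ⋆ g) n ≈ 0#
    tail zero    = refl
    tail (suc n) = trans (ΣΔ-cong n (λ i j → zeroˡ (g j))) (sum-zero (upTo (suc n)) (λ _ → refl))

  ⋆-assoc : ∀ n (f g h : PS R) → ((f ⋆ g) ⋆ h) n ≈ (f ⋆ (g ⋆ h)) n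
  ⋆-assoc zero f g h =
    solve 3 (λ x y z → ((x :* y :+ con 0) :* z) :+ con 0 := x :* (y :* z :+ con 0) :+ con 0) refl (f 0) (g 0) (h 0)
  ⋆-assoc (suc n) f g h = begin
    ((f ⋆ g) ⋆ h) (suc n)
      ≈⟨ ⋆-first (suc n) (f ⋆ g) h ⟩
    (f ⋆ g) 0 * h (suc n) + (((f ⋆ g) ∘ suc) ⋆ h) n
      ≈⟨ +-congˡ (⋆-cong n {g = h} (λ i → ⋆-first (suc i) f g) (λ _ → refl)) ⟩
    (f ⋆ g) 0 * h (suc n) + ((λ i → f 0 * g (suc i) + ((f ∘ suc) ⋆ g) i) ⋆ h) n
      ≈⟨ +-congˡ (⋆-distribʳ n (scale R (f 0) (g ∘ suc)) ((f ∘ suc) ⋆ g) h) ⟩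
    (f ⋆ g) 0 * h (suc n) + ((scale R (f 0) (g ∘ suc) ⋆ h) n + (((f ∘ suc) ⋆ g) ⋆ h) n)
      ≈⟨ +-congˡ (+-cong (⋆-scaleˡ n (f 0) (g ∘ suc) h) (⋆-assoc n (f ∘ suc) g h)) ⟩
    (f ⋆ g) 0 * h (suc n) + (f 0 * ((g ∘ suc) ⋆ h) n + ((f ∘ suc) ⋆ (g ⋆ h)) n)
      ≈⟨ solve 5 (λ x y z u w → ((x :* y :+ con 0) :* z) :+ (x :* u :+ w) := x :* (y :* z :+ u) :+ w)
           refl (f 0) (g 0) (h (suc n)) (((g ∘ suc) ⋆ h) n) (((f ∘ suc) ⋆ (g ⋆ h)) n) ⟩
    f 0 * (g 0 * h (suc n) + ((g ∘ suc) ⋆ h) n) + ((f ∘ suc) ⋆ (g ⋆ h)) n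
      ≈⟨ +-congʳ (*-congˡ (sym (⋆-first (suc n) g h))) ⟩
    f 0 * (g ⋆ h) (suc n) + ((f ∘ suc) ⋆ (g ⋆ h)) n
      ≈⟨ sym (⋆-first (suc n) f (g ⋆ h)) ⟩
    (f ⋆ (g ⋆ h)) (suc n) ∎

  ΣΔ-⋆ˡ : ∀ n (Y : PS R) (Z : ℕ → PS R) → ΣΔ (λ k → Y ⋆ Z k) n ≈ (Y ⋆ ΣΔ Z) n
  ΣΔ-⋆ˡ n Y Z = begin
    ΣΔ (λ k → Y ⋆ Z k) n
      ≈⟨ ΣΔ-cong n (λ k j → ⋆-first j Y (Z k)) ⟩
    ΣΔ (λ k j → Y 0 * Z k j + shift ((Y ∘ suc) ⋆ Z k) j) n
      ≈⟨ ΣΔ-+ n (λ k j → Y 0 * Z k j) (λ k → shift ((Y ∘ suc) ⋆ Z k)) ⟩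
    ΣΔ (λ k j → Y 0 * Z k j) n + ΣΔ (λ k → shift ((Y ∘ suc) ⋆ Z k)) n
      ≈⟨ +-cong (ΣΔ-*ˡ n (Y 0) Z) (ΣΔ-shift n (λ k → (Y ∘ suc) ⋆ Z k)) ⟩
    Y 0 * ΣΔ Z n + shift (ΣΔ (λ k → (Y ∘ suc) ⋆ Z k)) n
      ≈⟨ +-congˡ (shifted n) ⟩
    Y 0 * ΣΔ Z n + shift ((Y ∘ suc) ⋆ ΣΔ Z) n
      ≈⟨ sym (⋆-first n Y (ΣΔ Z)) ⟩
    (Y ⋆ ΣΔ Z) n ∎
    where
    shifted : ∀ n → shift (ΣΔ (λ k → (Y ∘ suc) ⋆ Z k)) n ≈ shift ((Y ∘ suc) ⋆ ΣΔ Z) n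
    shifted zero    = refl
    shifted (suc n) = ΣΔ-⋆ˡ n (Y ∘ suc) Z

  powPS-cong : ∀ k {Y Y′ : PS R} → _≋_ R Y Y′ → _≋_ R (powPS R Y k) (powPS R Y′ k)
  powPS-cong zero    Y≈Y′ n = refl
  powPS-cong (suc k) Y≈Y′ n = ⋆-cong n Y≈Y′ (powPS-cong k Y≈Y′)

  geo-cong : ∀ {Y Y′ : PS R} → _≋_ R Y Y′ → _≋_ R (geo R Y) (geo R Y′)
  geo-cong Y≈Y′ n = ΣΔ-cong n (λ k → powPS-cong k Y≈Y′)

  geo-zero : ∀ Y → geo R Y 0 ≈ 1#
  geo-zero Y = +-identityʳ 1#

  geo-suc : ∀ Y n → geo R Y (suc n) ≈ (Y ⋆ geo R Y) n
  geo-suc Y n = begin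
    geo R Y (suc n)                                  ≈⟨ ΣΔ-first (suc n) (powPS R Y) ⟩
    0# + ΣΔ (λ k → Y ⋆ powPS R Y k) n                ≈⟨ +-identityˡ _ ⟩
    ΣΔ (λ k → Y ⋆ powPS R Y k) n                     ≈⟨ ΣΔ-⋆ˡ n Y (powPS R Y) ⟩
    (Y ⋆ geo R Y) n                                  ∎

  geo-scale-suc : ∀ x G n → geo R (scale R x G) (suc n) ≈ x * (G ⋆ geo R (scale R x G)) n
  geo-scale-suc x G n = trans (geo-suc (scale R x G) n) (⋆-scaleˡ n x G (geo R (scale R x G)))

  first-return : ∀ x {F G : PS R} → F 0 ≈ 1# → (∀ i → F (suc i) ≈ x * (G ⋆ F) i) →
                 ∀ P m → (F ⋆ P) (suc m) ≈ P (suc m) + x * (G ⋆ (F ⋆ P)) m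
  first-return x {F} {G} F₀≈1 F-suc P m = begin
    (F ⋆ P) (suc m)                         ≈⟨ ⋆-first (suc m) F P ⟩
    F 0 * P (suc m) + ((F ∘ suc) ⋆ P) m     ≈⟨ +-cong (trans (*-congʳ F₀≈1) (*-identityˡ _))
                                                      (⋆-cong m {g = P} F-suc (λ _ → refl)) ⟩
    P (suc m) + (scale R x (G ⋆ F) ⋆ P) m   ≈⟨ +-congˡ (⋆-scaleˡ m x (G ⋆ F) P) ⟩
    P (suc m) + x * ((G ⋆ F) ⋆ P) m         ≈⟨ +-congˡ (*-congˡ (⋆-assoc m G F P)) ⟩
    P (suc m) + x * (G ⋆ (F ⋆ P)) m         ∎

indicator : ∀ {p} {P : Set p} → Dec P → ℕ
indicator P? = if does P? then 1 else 0

length-filter-∷ : ∀ {A : Set} {P : A → Set} (P? : Decidable P) x xs →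
                  length (filter P? (x ∷ xs)) ≡ indicator (P? x) ℕ.+ length (filter P? xs)
length-filter-∷ P? x xs with does (P? x)
... | true  = ≡.refl
... | false = ≡.refl

-- Weighted sums over the walks that start at an arbitrary height y and
-- stay in the strip 0 ≤ y ≤ h; the statistics of D_h are counted along
-- the walk, so the weight of a walk factors into one weight per step.
module Walks {c ℓ} (R : CommutativeRing c ℓ) (h : ℕ) (a b q : CommutativeRing.Carrier R) where
  open CommutativeRing R
  open RingSums R
  open import Algebra.Solver.Ring.NaturalCoefficients.Default commutativeSemiring
  open import Relation.Binary.Reasoning.Setoid setoid

  InStrip : ℤ → Set
  InStrip y = (0ℤ ℤ.≤ y) × (y ℤ.≤ + h)

  Admissible : ℤ → List Step → Set
  Admissible y p = All InStrip (vertices y p) × (endHeight y p ≡ 0ℤ)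

  admissible? : ∀ y p → Dec (Admissible y p)
  admissible? y p = all? (λ z → (0ℤ ℤ.≤? z) ×-dec (z ℤ.≤? + h)) (vertices y p) ×-dec (endHeight y p ℤ.≟ 0ℤ)

  zerosFrom topsFrom areaFrom : ℤ → List Step → ℕ
  zerosFrom y p = length (filter (λ z → z ℤ.≟ 0ℤ) (drop 1 (vertices y p)))
  topsFrom  y p = length (filter (λ z → z ℤ.≟ + h) (vertices y p))
  areaFrom  y p = foldr ℕ._+_ 0 (map ∣_∣ (upHeights y p))

  weightFrom : ℤ → List Step → Carrier
  weightFrom y p = pow R a (zerosFrom y p) * (pow R b (topsFrom y p) * pow R q (areaFrom y p))

  upArea : ℤ → Step → ℕ
  upArea y U = ∣ y ∣
  upArea y D = 0

  stepWeight : ℤ → Step → Carrier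
  stepWeight y s = pow R a (indicator (next y s ℤ.≟ 0ℤ)) * (pow R b (indicator (y ℤ.≟ + h)) * pow R q (upArea y s))

  zerosFrom-∷ : ∀ y s w → zerosFrom y (s ∷ w) ≡ indicator (next y s ℤ.≟ 0ℤ) ℕ.+ zerosFrom (next y s) w
  zerosFrom-∷ y s []      = length-filter-∷ (λ z → z ℤ.≟ 0ℤ) (next y s) []
  zerosFrom-∷ y s (_ ∷ w) = length-filter-∷ (λ z → z ℤ.≟ 0ℤ) (next y s) _

  topsFrom-∷ : ∀ y s w → topsFrom y (s ∷ w) ≡ indicator (y ℤ.≟ + h) ℕ.+ topsFrom (next y s) w
  topsFrom-∷ y s w = length-filter-∷ (λ z → z ℤ.≟ + h) y _

  areaFrom-∷ : ∀ y s w → areaFrom y (s ∷ w) ≡ upArea y s ℕ.+ areaFrom (next y s) w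
  areaFrom-∷ y U w = ≡.refl
  areaFrom-∷ y D w = ≡.refl

  weightFrom-∷ : ∀ y s w → weightFrom y (s ∷ w) ≈ stepWeight y s * weightFrom (next y s) w
  weightFrom-∷ y s w = begin
    pow R a (zerosFrom y (s ∷ w)) * (pow R b (topsFrom y (s ∷ w)) * pow R q (areaFrom y (s ∷ w)))
      ≡⟨ ≡.cong₂ (λ i j → pow R a i * (pow R b j * pow R q (areaFrom y (s ∷ w)))) (zerosFrom-∷ y s w) (topsFrom-∷ y s w) ⟩
    pow R a (i₀ ℕ.+ u) * (pow R b (iₕ ℕ.+ v) * pow R q (areaFrom y (s ∷ w)))
      ≡⟨ ≡.cong (λ k → pow R a (i₀ ℕ.+ u) * (pow R b (iₕ ℕ.+ v) * pow R q k)) (areaFrom-∷ y s w) ⟩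
    pow R a (i₀ ℕ.+ u) * (pow R b (iₕ ℕ.+ v) * pow R q (m₀ ℕ.+ m))
      ≈⟨ *-cong (pow-+ a i₀ u) (*-cong (pow-+ b iₕ v) (pow-+ q m₀ m)) ⟩
    (pow R a i₀ * pow R a u) * ((pow R b iₕ * pow R b v) * (pow R q m₀ * pow R q m))
      ≈⟨ solve 6 (λ a₀ a₁ b₀ b₁ q₀ q₁ → (a₀ :* a₁) :* ((b₀ :* b₁) :* (q₀ :* q₁)) := (a₀ :* (b₀ :* q₀)) :* (a₁ :* (b₁ :* q₁)))
           refl _ _ _ _ _ _ ⟩
    stepWeight y s * weightFrom (next y s) w ∎
    where
    i₀ = indicator (next y s ℤ.≟ 0ℤ)
    iₕ = indicator (y ℤ.≟ + h)
    m₀ = upArea y s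
    u = zerosFrom (next y s) w
    v = topsFrom (next y s) w
    m = areaFrom (next y s) w

  value : ℤ → List Step → Carrier
  value y p = keep (admissible? y p) (weightFrom y p)

  value-∷ : ∀ y s w → InStrip y → value y (s ∷ w) ≈ stepWeight y s * value (next y s) w
  value-∷ y s w y∈ with admissible? y (s ∷ w) | admissible? (next y s) w
  ... | yes _              | yes _            = weightFrom-∷ y s w
  ... | yes (_ ∷ rest , e) | no ¬adm          = ⊥-elim (¬adm (rest , e))
  ... | no ¬adm            | yes (rest , e)   = ⊥-elim (¬adm (y∈ ∷ rest , e))
  ... | no _               | no _             = sym (zeroʳ _)

  value-outside : ∀ y w → ¬ InStrip y → value y w ≈ 0#
  value-outside y w y∉ with admissible? y w
  ... | yes (vs , _) = ⊥-elim (y∉ (start∈ w vs))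
    where
    start∈ : ∀ w → All InStrip (vertices y w) → InStrip y
    start∈ []      (y∈ ∷ _) = y∈
    start∈ (_ ∷ _) (y∈ ∷ _) = y∈
  ... | no _         = refl

  paths : ℤ → ℕ → Carrier
  paths y k = sumR R (map (value y) (words k))

  sum-words-suc : ∀ k (g : List Step → Carrier) →
                  sumR R (map g (words (suc k))) ≈ sumR R (map (λ w → g (U ∷ w) + g (D ∷ w)) (words k))
  sum-words-suc k g = go (words k)
    where
    go : ∀ ws → sumR R (map g (concatMap (λ w → (U ∷ w) ∷ (D ∷ w) ∷ []) ws))
              ≈ sumR R (map (λ w → g (U ∷ w) + g (D ∷ w)) ws)
    go []       = refl
    go (w ∷ ws) = trans (+-congˡ (+-congˡ (go ws))) (sym (+-assoc _ _ _))

  paths-suc : ∀ y k → InStrip y →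
              paths y (suc k) ≈ stepWeight y U * paths (next y U) k + stepWeight y D * paths (next y D) k
  paths-suc y k y∈ = begin
    paths y (suc k)
      ≈⟨ sum-words-suc k (value y) ⟩
    sumR R (map (λ w → value y (U ∷ w) + value y (D ∷ w)) (words k))
      ≈⟨ sum-cong (words k) (λ w → +-cong (value-∷ y U w y∈) (value-∷ y D w y∈)) ⟩
    sumR R (map (λ w → stepWeight y U * value (next y U) w + stepWeight y D * value (next y D) w) (words k))
      ≈⟨ sum-+ (words k) _ _ ⟩
    sumR R (map (λ w → stepWeight y U * value (next y U) w) (words k))
      + sumR R (map (λ w → stepWeight y D * value (next y D) w) (words k))
      ≈⟨ +-cong (sum-*ˡ (words k) _ _) (sum-*ˡ (words k) _ _) ⟩
    stepWeight y U * paths (next y U) k + stepWeight y D * paths (next y D) k ∎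

  paths-outside : ∀ y k → ¬ InStrip y → paths y k ≈ 0#
  paths-outside y k y∉ = sum-zero (words k) (λ w → value-outside y w y∉)

  Dgf-paths : ∀ n → Dgf R h a b q n ≈ paths 0ℤ (n ℕ.+ n)
  Dgf-paths n = trans (sum-filter (isDyck≤? h) (words (2 ℕ.* n)) (weight R h a b q))
                      (reflexive (≡.cong (λ k → paths 0ℤ (n ℕ.+ k)) (NP.+-identityʳ n)))

module Heights {c ℓ} (R : CommutativeRing c ℓ) (h : ℕ) (a b q : CommutativeRing.Carrier R) where
  open CommutativeRing R hiding (zero)
  open Walks R h a b q
  open import Relation.Binary.Reasoning.Setoid setoid

  up down : ℕ → Carrier
  up   y = stepWeight (+ y) U
  down y = stepWeight (+ y) D

  next-U : ∀ y → next (+ y) U ≡ + suc y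
  next-U y = ≡.cong +_ (NP.+-comm y 1)

  in-strip : ∀ {y} → y ≤ h → InStrip (+ y)
  in-strip y≤h = +≤+ z≤n , +≤+ y≤h

  above-strip : ∀ {y} → h < y → ¬ InStrip (+ y)
  above-strip h<y (_ , +≤+ y≤h) = NP.<⇒≱ h<y y≤h

  below-strip : ¬ InStrip -[1+ 0 ]
  below-strip (() , _)

  top-indicator-below : ∀ {y} → y < h → indicator (+ y ℤ.≟ + h) ≡ 0
  top-indicator-below y<h =
    ≡.cong (λ d → if d then 1 else 0) (dec-false (_ ℤ.≟ + h) (λ y≡h → NP.<⇒≢ y<h (IP.+-injective y≡h)))

  top-indicator-at : ∀ {y} → y ≡ h → indicator (+ y ℤ.≟ + h) ≡ 1
  top-indicator-at ≡.refl = ≡.cong (λ d → if d then 1 else 0) (dec-true (+ h ℤ.≟ + h) ≡.refl)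

  paths-suc-interior : ∀ y k → suc y ≤ h →
    paths (+ suc y) (suc k) ≈ up (suc y) * paths (+ suc (suc y)) k + down (suc y) * paths (+ y) k
  paths-suc-interior y k y<h = begin
    paths (+ suc y) (suc k)
      ≈⟨ paths-suc (+ suc y) k (in-strip y<h) ⟩
    up (suc y) * paths (next (+ suc y) U) k + down (suc y) * paths (+ y) k
      ≡⟨ ≡.cong (λ z → up (suc y) * paths z k + down (suc y) * paths (+ y) k) (next-U (suc y)) ⟩
    up (suc y) * paths (+ suc (suc y)) k + down (suc y) * paths (+ y) k ∎

  paths-suc-floor : ∀ k → paths (+ 0) (suc k) ≈ up 0 * paths (+ 1) k
  paths-suc-floor k = begin
    paths (+ 0) (suc k)
      ≈⟨ paths-suc (+ 0) k (in-strip z≤n) ⟩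
    up 0 * paths (next (+ 0) U) k + down 0 * paths -[1+ 0 ] k
      ≈⟨ +-congˡ (trans (*-congˡ (paths-outside -[1+ 0 ] k below-strip)) (zeroʳ _)) ⟩
    up 0 * paths (+ 1) k + 0#
      ≈⟨ +-identityʳ _ ⟩
    up 0 * paths (+ 1) k ∎

  paths-too-short : ∀ L y → L < y → paths (+ y) L ≈ 0#
  paths-too-short L y L<y with h ℕ.<? y
  ... | yes h<y = paths-outside (+ y) L (above-strip h<y)
  paths-too-short zero (suc y) L<y | no _ with admissible? (+ suc y) []
  ... | yes (_ , ())
  ... | no _ = +-identityˡ 0#
  paths-too-short (suc L) (suc y) (s≤s L<y) | no h≮y = begin
    paths (+ suc y) (suc L)
      ≈⟨ paths-suc-interior y L (NP.≮⇒≥ h≮y) ⟩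
    up (suc y) * paths (+ suc (suc y)) L + down (suc y) * paths (+ y) L
      ≈⟨ +-cong (*-congˡ (paths-too-short L (suc (suc y)) (NP.m<n⇒m<1+n (NP.m<n⇒m<1+n L<y))))
                (*-congˡ (paths-too-short L y L<y)) ⟩
    up (suc y) * 0# + down (suc y) * 0#
      ≈⟨ trans (+-cong (zeroʳ _) (zeroʳ _)) (+-identityˡ 0#) ⟩
    0# ∎

-- An admissible walk from height y to 0 splits
-- at its last visits to y, y-1, …, 0 into excursions joined by down steps;
-- an excursion above height x is a sequence of arches, each an up step from x,
-- an excursion above x+1, and a down step back to x.
module Excursions {c ℓ} (R : CommutativeRing c ℓ) (h : ℕ) (a b q : CommutativeRing.Carrier R) where
  open CommutativeRing R hiding (zero)
  open Series R
  open Walks R h a b q using (Dgf-paths)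
  open Heights R h a b q public

  -- Weight of the two steps delimiting an arch on top of height y.
  arch : ℕ → Carrier
  arch y = up y * down (suc y)

  -- Excursions above height y of height at most r: 1/(1 - arch y · t · excursions (r-1) (y+1)).
  excursions : ℕ → ℕ → PS R
  excursions zero    y = constPS R 1#
  excursions (suc r) y = geo R (scale R (arch y) (excursions r (suc y)))

  E : ℕ → PS R
  E y = excursions (h ∸ y) y

  -- Walks from height y down to 0, by half the number of steps beyond the first y.
  descents : ℕ → PS R
  descents zero    = E 0
  descents (suc y) = E (suc y) ⋆ descents y

  descentWeight : ℕ → Carrier
  descentWeight zero    = 1#
  descentWeight (suc y) = down (suc y) * descentWeight y

  E-below-top : ∀ y → y < h → E y ≡ geo R (scale R (arch y) (E (suc y)))
  E-below-top y y<h rewrite NP.+-∸-assoc 1 y<h = ≡.refl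

  E-top : E h ≡ constPS R 1#
  E-top rewrite NP.n∸n≡0 h = ≡.refl

  E-zero : ∀ y → y ≤ h → E y 0 ≈ 1#
  E-zero y y≤h with NP.m≤n⇒m<n∨m≡n y≤h
  ... | inj₁ y<h    rewrite E-below-top y y<h = geo-zero (scale R (arch y) (E (suc y)))
  ... | inj₂ ≡.refl rewrite E-top = refl

  E-suc : ∀ y → y < h → ∀ n → E y (suc n) ≈ arch y * (E (suc y) ⋆ E y) n
  E-suc y y<h n rewrite E-below-top y y<h = geo-scale-suc (arch y) (E (suc y)) n

  -- Recurrences for descents, from the first-return decomposition of E (y+1).
  descents-suc-below : ∀ y m → suc y < h →
    descents (suc y) (suc m) ≈ descents y (suc m) + arch (suc y) * descents (suc (suc y)) m
  descents-suc-below y m y+1<h =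
    first-return (arch (suc y)) (E-zero (suc y) (NP.<⇒≤ y+1<h)) (E-suc (suc y) y+1<h) (descents y) m

  descents-suc-top : ∀ y n → suc y ≡ h → descents (suc y) n ≈ descents y n
  descents-suc-top y n ≡.refl rewrite E-top = ⋆-identityˡ n (descents y)

  -- Admissible walks from height y have length y + 2m.
  walkLength : ℕ → ℕ → ℕ
  walkLength y m = y ℕ.+ (m ℕ.+ m)

  walkLength-suc : ∀ y m → walkLength y (suc m) ≡ suc (suc (walkLength y m))
  walkLength-suc y m = ≡.trans (≡.cong (λ k → y ℕ.+ suc k) (NP.+-suc m m))
                               (≡.trans (NP.+-suc y _) (≡.cong suc (NP.+-suc y _)))

  -- The transfer equation is solved by descentWeight y · descents y.
  module ClosedForm (0<h : 0 < h) where
    open Walks R h a b q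
    open import Algebra.Solver.Ring.NaturalCoefficients.Default commutativeSemiring
    open import Relation.Binary.Reasoning.Setoid setoid

    Solves : ℕ → ℕ → Set ℓ
    Solves m y = paths (+ y) (walkLength y m) ≈ descentWeight y * descents y m

    -- The empty walk: its only vertex lies on y = 0 and, as h > 0, not on y = h.
    paths-empty : paths (+ 0) 0 ≈ 1#
    paths-empty with admissible? (+ 0) []
    ... | no ¬adm = ⊥-elim (¬adm ((in-strip z≤n ∷ []) , ≡.refl))
    ... | yes _   = begin
      pow R a 0 * (pow R b (topsFrom (+ 0) []) * pow R q 0) + 0#
        ≡⟨ ≡.cong (λ k → pow R a 0 * (pow R b k * pow R q 0) + 0#) origin-not-top ⟩
      1# * (1# * 1#) + 0#
        ≈⟨ solve 0 (con 1 :* (con 1 :* con 1) :+ con 0 := con 1) refl ⟩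
      1# ∎
      where
      origin-not-top : topsFrom (+ 0) [] ≡ 0
      origin-not-top = ≡.trans (length-filter-∷ (λ z → z ℤ.≟ + h) (+ 0) []) (≡.cong (ℕ._+ 0) (top-indicator-below 0<h))

    -- Walks of the minimal length y + 1 from height y + 1: down steps only.
    climb-shortest : ∀ y → suc y ≤ h → Solves 0 y → Solves 0 (suc y)
    climb-shortest y y<h ih = begin
      paths (+ suc y) (suc (walkLength y 0))
        ≈⟨ paths-suc-interior y (walkLength y 0) y<h ⟩
      up (suc y) * paths (+ suc (suc y)) (walkLength y 0) + down (suc y) * paths (+ y) (walkLength y 0)
        ≈⟨ +-cong (*-congˡ (paths-too-short (walkLength y 0) (suc (suc y)) too-short)) (*-congˡ ih) ⟩
      up (suc y) * 0# + down (suc y) * (descentWeight y * descents y 0)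
        ≈⟨ solve 4 (λ u d w D → u :* con 0 :+ d :* (w :* D) := (d :* w) :* (con 1 :* D :+ con 0))
             refl (up (suc y)) (down (suc y)) (descentWeight y) (descents y 0) ⟩
      (down (suc y) * descentWeight y) * (1# * descents y 0 + 0#)
        ≈⟨ *-congˡ (+-congʳ (*-congʳ (sym (E-zero (suc y) y<h)))) ⟩
      descentWeight (suc y) * descents (suc y) 0 ∎
      where
      too-short : walkLength y 0 < suc (suc y)
      too-short = s≤s (NP.≤-trans (NP.≤-reflexive (NP.+-identityʳ y)) (NP.n≤1+n y))

    climb-floor : ∀ m → Solves m 1 → Solves (suc m) 0
    climb-floor m ih = begin
      paths (+ 0) (walkLength 0 (suc m))
        ≡⟨ ≡.cong (paths (+ 0)) (walkLength-suc 0 m) ⟩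
      paths (+ 0) (suc (suc (walkLength 0 m)))
        ≈⟨ paths-suc-floor (walkLength 1 m) ⟩
      up 0 * paths (+ 1) (walkLength 1 m)
        ≈⟨ *-congˡ ih ⟩
      up 0 * ((down 1 * 1#) * descents 1 m)
        ≈⟨ solve 3 (λ u d D → u :* ((d :* con 1) :* D) := con 1 :* ((u :* d) :* D))
             refl (up 0) (down 1) (descents 1 m) ⟩
      1# * (arch 0 * (E 1 ⋆ E 0) m)
        ≈⟨ *-congˡ (sym (E-suc 0 0<h m)) ⟩
      descentWeight 0 * descents 0 (suc m) ∎

    first-step : ∀ m y → suc y ≤ h → Solves (suc m) y →
      paths (+ suc y) (walkLength (suc y) (suc m))
        ≈ up (suc y) * paths (+ suc (suc y)) (walkLength (suc (suc y)) m) + down (suc y) * (descentWeight y * descents y (suc m))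
    first-step m y y<h ih-below = begin
      paths (+ suc y) (suc (walkLength y (suc m)))
        ≈⟨ paths-suc-interior y (walkLength y (suc m)) y<h ⟩
      up (suc y) * paths (+ suc (suc y)) (walkLength y (suc m)) + down (suc y) * paths (+ y) (walkLength y (suc m))
        ≡⟨ ≡.cong (λ k → up (suc y) * paths (+ suc (suc y)) k + down (suc y) * paths (+ y) (walkLength y (suc m))) (walkLength-suc y m) ⟩
      up (suc y) * paths (+ suc (suc y)) (walkLength (suc (suc y)) m) + down (suc y) * paths (+ y) (walkLength y (suc m))
        ≈⟨ +-congˡ (*-congˡ ih-below) ⟩
      up (suc y) * paths (+ suc (suc y)) (walkLength (suc (suc y)) m) + down (suc y) * (descentWeight y * descents y (suc m)) ∎

    climb : ∀ m y → suc y ≤ h → (suc (suc y) ≤ h → Solves m (suc (suc y))) → Solves (suc m) y →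
            Solves (suc m) (suc y)
    climb m y y<h ih-above ih-below with suc (suc y) ℕ.≤? h
    ... | yes y+2≤h = begin
      paths (+ suc y) (walkLength (suc y) (suc m))
        ≈⟨ first-step m y y<h ih-below ⟩
      up (suc y) * paths (+ suc (suc y)) (walkLength (suc (suc y)) m) + down (suc y) * (descentWeight y * descents y (suc m))
        ≈⟨ +-congʳ (*-congˡ (ih-above y+2≤h)) ⟩
      up (suc y) * ((down (suc (suc y)) * (down (suc y) * descentWeight y)) * descents (suc (suc y)) m)
        + down (suc y) * (descentWeight y * descents y (suc m))
        ≈⟨ solve 6 (λ u d d′ w D D′ → u :* ((d′ :* (d :* w)) :* D′) :+ d :* (w :* D) := (d :* w) :* (D :+ (u :* d′) :* D′))
             refl (up (suc y)) (down (suc y)) (down (suc (suc y))) (descentWeight y) (descents y (suc m)) (descents (suc (suc y)) m) ⟩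
      descentWeight (suc y) * (descents y (suc m) + arch (suc y) * descents (suc (suc y)) m)
        ≈⟨ *-congˡ (sym (descents-suc-below y m y+2≤h)) ⟩
      descentWeight (suc y) * descents (suc y) (suc m) ∎
    ... | no y+2≰h = begin
      paths (+ suc y) (walkLength (suc y) (suc m))
        ≈⟨ first-step m y y<h ih-below ⟩
      up (suc y) * paths (+ suc (suc y)) (walkLength (suc (suc y)) m) + down (suc y) * (descentWeight y * descents y (suc m))
        ≈⟨ +-congʳ (*-congˡ (paths-outside (+ suc (suc y)) (walkLength (suc (suc y)) m) (above-strip (NP.≰⇒> y+2≰h)))) ⟩
      up (suc y) * 0# + down (suc y) * (descentWeight y * descents y (suc m))
        ≈⟨ solve 4 (λ u d w D → u :* con 0 :+ d :* (w :* D) := (d :* w) :* D)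
             refl (up (suc y)) (down (suc y)) (descentWeight y) (descents y (suc m)) ⟩
      descentWeight (suc y) * descents y (suc m)
        ≈⟨ *-congˡ (sym (descents-suc-top y (suc m) y+1≡h)) ⟩
      descentWeight (suc y) * descents (suc y) (suc m) ∎
      where
      y+1≡h : suc y ≡ h
      y+1≡h = NP.≤-antisym y<h (NP.≤-pred (NP.≰⇒> y+2≰h))

    -- Lexicographic induction on (m, y).
    closed-form : ∀ m y → y ≤ h → Solves m y
    closed-form zero    zero    _   = trans paths-empty (trans (sym (*-identityˡ 1#)) (*-congˡ (sym (E-zero 0 z≤n))))
    closed-form zero    (suc y) y<h = climb-shortest y y<h (closed-form zero y (NP.<⇒≤ y<h))
    closed-form (suc m) zero    _   = climb-floor m (closed-form m 1 0<h)
    closed-form (suc m) (suc y) y<h = climb m y y<h (closed-form m (suc (suc y))) (closed-form (suc m) y (NP.<⇒≤ y<h))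

  excursions-as-cf : ∀ r y (g : ℕ → Carrier) → (∀ k → k < r → g k ≈ arch (y ℕ.+ k)) →
                     ∀ {d} → arch (y ℕ.+ r) ≈ d → _≋_ R (excursions (suc r) y) (cf R (applyUpTo g r) d)
  excursions-as-cf zero y g _ arch≈d = geo-cong λ
    { zero    → trans (*-identityʳ _) (trans (reflexive (≡.cong arch (≡.sym (NP.+-identityʳ y)))) arch≈d)
    ; (suc i) → zeroʳ _ }
  excursions-as-cf (suc r) y g g≈arch {d} arch≈d = geo-cong λ i →
    *-cong (trans (reflexive (≡.cong arch (≡.sym (NP.+-identityʳ y)))) (sym (g≈arch 0 (s≤s z≤n))))
           (excursions-as-cf r (suc y) (g ∘ suc) g∘suc≈arch arch≈d′ i)
    where
    arch≈d′ : arch (suc y ℕ.+ r) ≈ d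
    arch≈d′ = trans (reflexive (≡.cong arch (≡.sym (NP.+-suc y r)))) arch≈d

    g∘suc≈arch : ∀ k → k < r → g (suc k) ≈ arch (suc y ℕ.+ k)
    g∘suc≈arch k k<r = trans (g≈arch (suc k) (s≤s k<r)) (reflexive (≡.cong arch (NP.+-suc y k)))

  Dgf-excursions : 0 < h → _≋_ R (Dgf R h a b q) (E 0)
  Dgf-excursions 0<h n = trans (Dgf-paths n) (trans (closed-form n 0 z≤n) (*-identityˡ _))
    where open ClosedForm 0<h

-- Explicit arch weights: an arch from height y < h contributes q^y, and the
-- lines y = 0 and y = h are touched only by arches from heights 0 and h - 1.
module ArchWeights {c ℓ} (R : CommutativeRing c ℓ) (h : ℕ) (a b q : CommutativeRing.Carrier R) where
  open CommutativeRing R hiding (zero)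
  open Excursions R h a b q
  open import Relation.Binary.Reasoning.Setoid setoid
  open import Algebra.Solver.Ring.NaturalCoefficients.Default commutativeSemiring

  up-below-top : ∀ y → y < h → up y ≈ pow R q y
  up-below-top y y<h = begin
    pow R a (indicator (next (+ y) U ℤ.≟ 0ℤ)) * (pow R b (indicator (+ y ℤ.≟ + h)) * pow R q y)
      ≡⟨ ≡.cong₂ (λ i j → pow R a i * (pow R b j * pow R q y)) (≡.cong (λ z → indicator (z ℤ.≟ 0ℤ)) (next-U y)) (top-indicator-below y<h) ⟩
    1# * (1# * pow R q y)
      ≈⟨ trans (*-identityˡ _) (*-identityˡ _) ⟩
    pow R q y ∎

  arch-below-top : ∀ y i j → y < h → indicator (+ y ℤ.≟ 0ℤ) ≡ i → indicator (+ suc y ℤ.≟ + h) ≡ j →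
    arch y ≈ pow R q y * (pow R a i * pow R b j)
  arch-below-top y _ _ y<h ≡.refl ≡.refl = *-cong (up-below-top y y<h) (*-congˡ (*-identityʳ _))

  arch-floor : 1 < h → arch 0 ≈ a
  arch-floor 1<h = trans (arch-below-top 0 1 0 (NP.<-trans (s≤s z≤n) 1<h) ≡.refl (top-indicator-below 1<h))
    (solve 1 (λ x → con 1 :* ((x :* con 1) :* con 1) := x) refl a)

  arch-interior : ∀ y → suc (suc y) < h → arch (suc y) ≈ pow R q (suc y)
  arch-interior y y+2<h = trans (arch-below-top (suc y) 0 0 (NP.<-trans (NP.n<1+n _) y+2<h) ≡.refl (top-indicator-below y+2<h))
    (solve 1 (λ x → x :* (con 1 :* con 1) := x) refl (pow R q (suc y)))

  arch-top : ∀ y → suc (suc y) ≡ h → arch (suc y) ≈ b * pow R q (suc y)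
  arch-top y y+2≡h = trans (arch-below-top (suc y) 0 1 (NP.≤-reflexive y+2≡h) ≡.refl (top-indicator-at y+2≡h))
    (solve 2 (λ x z → x :* (con 1 :* (z :* con 1)) := z :* x) refl (pow R q (suc y)) b)

  arch-floor-top : 1 ≡ h → arch 0 ≈ a * b
  arch-floor-top 1≡h = trans (arch-below-top 0 1 1 (NP.≤-reflexive 1≡h) ≡.refl (top-indicator-at 1≡h))
    (solve 2 (λ x z → con 1 :* ((x :* con 1) :* (z :* con 1)) := x :* z) refl a b)

-- In the degenerate strip h = 0 only the empty path survives, with v = 1.
module HeightZero {c ℓ} (R : CommutativeRing c ℓ) (a b q : CommutativeRing.Carrier R) where
  open CommutativeRing R hiding (zero)
  open Walks R 0 a b q
  open Heights R 0 a b q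
  open import Relation.Binary.Reasoning.Setoid setoid

  Dgf-height-zero : _≋_ R (Dgf R 0 a b q) (constPS R b)
  Dgf-height-zero zero with admissible? (+ 0) []
  ... | yes _   = trans (+-identityʳ _) (trans (*-identityˡ _) (trans (*-identityʳ _) (*-identityʳ _)))
  ... | no ¬adm = ⊥-elim (¬adm ((in-strip z≤n ∷ []) , ≡.refl))
  Dgf-height-zero (suc n) = begin
    Dgf R 0 a b q (suc n)                         ≈⟨ Dgf-paths (suc n) ⟩
    paths (+ 0) (suc (n ℕ.+ suc n))               ≈⟨ paths-suc-floor (n ℕ.+ suc n) ⟩
    up 0 * paths (+ 1) (n ℕ.+ suc n)              ≈⟨ *-congˡ (paths-outside (+ 1) (n ℕ.+ suc n) (above-strip (s≤s z≤n))) ⟩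
    up 0 * 0#                                     ≈⟨ zeroʳ _ ⟩
    0#                                            ∎

module PositiveHeight {c ℓ} (R : CommutativeRing c ℓ) (a b q : CommutativeRing.Carrier R) where
  open CommutativeRing R hiding (zero)

  Dgf-height-one : _≋_ R (Dgf R 1 a b q) (geo R (constPS R (a * b)))
  Dgf-height-one n = trans (Dgf-excursions (s≤s z≤n) n)
                           (excursions-as-cf 0 0 (λ _ → a) (λ _ ()) (arch-floor-top ≡.refl) n)
    where
    open Excursions R 1 a b q
    open ArchWeights R 1 a b q

  Dgf-height-≥2 : ∀ h′ → _≋_ R (Dgf R (suc (suc h′)) a b q)
                                 (cf R (a ∷ map (λ k → pow R q (suc k)) (upTo h′)) (b * pow R q (suc h′)))
  Dgf-height-≥2 h′ n = begin
    Dgf R (suc (suc h′)) a b q n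
      ≈⟨ Dgf-excursions (s≤s z≤n) n ⟩
    E 0 n
      ≈⟨ excursions-as-cf (suc h′) 0 numerator numerator≈arch (arch-top h′ ≡.refl) n ⟩
    cf R (a ∷ applyUpTo (λ k → pow R q (suc k)) h′) (b * pow R q (suc h′)) n
      ≡⟨ ≡.cong (λ es → cf R (a ∷ es) (b * pow R q (suc h′)) n) (≡.sym (map-upTo (λ k → pow R q (suc k)) h′)) ⟩
    cf R (a ∷ map (λ k → pow R q (suc k)) (upTo h′)) (b * pow R q (suc h′)) n ∎
    where
    open Excursions R (suc (suc h′)) a b q
    open ArchWeights R (suc (suc h′)) a b q
    open import Relation.Binary.Reasoning.Setoid setoid

    numerator : ℕ → Carrier
    numerator zero    = a
    numerator (suc k) = pow R q (suc k)

    numerator≈arch : ∀ k → k < suc h′ → numerator k ≈ arch k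
    numerator≈arch zero    _           = sym (arch-floor (s≤s (s≤s z≤n)))
    numerator≈arch (suc k) (s≤s k<h′) = sym (arch-interior k (s≤s (s≤s k<h′)))

proposition3 : ∀ {c ℓ} (R : CommutativeRing c ℓ) → let open CommutativeRing R in
    (a b q : Carrier) →
    (_≋_ R (Dgf R 0 a b q) (constPS R b))
    × (_≋_ R (Dgf R 1 a b q) (geo R (constPS R (a * b))))
    × ((h : ℕ) → 2 ≤ h →
        _≋_ R (Dgf R h a b q)
          (cf R (a ∷ map (λ k → pow R q (suc k)) (upTo (h ∸ 2))) (b * pow R q (h ∸ 1))))
proposition3 R a b q = Dgf-height-zero , Dgf-height-one , λ
  { (suc (suc h′)) _       → Dgf-height-≥2 h′
  ; (suc zero)     (s≤s ())
  ; zero           () }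
  where
  open HeightZero R a b q
  open PositiveHeight R a b q
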